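{- Let $d\ge 2$ be a constant. There is a randomized algorithm which, given the vertex set $U(\mathcal{H})$ of a $d$-uniform hypergraph $\mathcal{H}$ (whose hyperedges are unknown), a positive integer $k$, and access to a GPIS oracle for $\mathcal{H}$, makes $\mathcal{O}(k^{2d^2}\log k)$ GPIS queries and, with probability at least $1-1/k^{c}$ for some constant $c>0$, correctly decides whether $\mathcal{H}$ has a hitting set (a vertex set intersecting every hyperedge) of size at most $k$.
   Context: The GPIS (generalized $d$-partite independent set) oracle takes as input $d$ pairwise disjoint non-empty subsets $A_1,\dots,A_d\subseteq U(\mathcal{H})$ and answers (yes/no only) whether there exists a hyperedge $\{u_1,\dots,u_d\}$ of $\mathcal{H}$ with $u_i\in A_i$ for all $i\in[d]$. Only oracle queries are counted. -}

module Defs where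

open import Data.Nat using (ℕ; zero; suc; _+_; _*_; _∸_; _^_; _≤_)
open import Data.Bool using (Bool; true; false; if_then_else_)
open import Data.Fin using (Fin)
open import Data.Fin.Subset using (Subset; _∈_; _∩_; ∣_∣; Nonempty; Empty)
open import Data.List using (List)
open import Data.List.Relation.Unary.All using (All)
open import Data.List.Relation.Unary.Any using (Any)
open import Data.List.Relation.Unary.Unique.Propositional using (Unique)
open import Data.Vec using (Vec)
open import Data.Product using (Σ; ∃; _×_; _,_)
open import Relation.Binary.PropositionalEquality using (_≡_; _≢_)
open import Relation.Nullary using (¬_)

record Hypergraph (d n : ℕ) : Set where
  field
    edges   : List (Subset n)
    uniform : All (λ e → ∣ e ∣ ≡ d) edges
open Hypergraph public

Query : ℕ → ℕ → Set
Query d n = Fin d → Subset n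

ValidQuery : ∀ {d n} → Query d n → Set
ValidQuery {d} A = (∀ i → Nonempty (A i)) × (∀ (i j : Fin d) → i ≢ j → Empty (A i ∩ A j))

EdgeFits : ∀ {d n} → Query d n → Subset n → Set
EdgeFits {d} {n} A e =
  Σ (Fin d → Fin n) λ u →
    (∀ i → u i ∈ A i) × (∀ v → (v ∈ e → ∃ λ i → u i ≡ v) × (∃ (λ i → u i ≡ v) → v ∈ e))

GPIS : ∀ {d n} → Hypergraph d n → Query d n → Set
GPIS H A = Any (EdgeFits A) (edges H)

data Answer {d n} (H : Hypergraph d n) (A : Query d n) : Bool → Set where
  yes : GPIS H A → Answer H A true
  no  : ¬ GPIS H A → Answer H A false

-- Deterministic adaptive query algorithm (decision tree) with yes/no output.
data QTree (d n : ℕ) : Set where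
  leaf  : Bool → QTree d n
  query : Query d n → (ifYes ifNo : QTree d n) → QTree d n

data Exec {d n} (H : Hypergraph d n) : QTree d n → Bool → ℕ → Set where
  done : ∀ b → Exec H (leaf b) b 0
  step : ∀ {A t₁ t₂ b out q} → ValidQuery A → Answer H A b →
         Exec H (if b then t₁ else t₂) out q →
         Exec H (query A t₁ t₂) out (suc q)

-- A randomized query algorithm: given n = |U(H)| and k, it uses r uniformly
-- random bits, and for each random string a decision tree (independent of H).
RandAlg : ℕ → Set
RandAlg d = (n k : ℕ) → Σ ℕ λ r → (Vec Bool r → QTree d n)

HasHittingSet : ∀ {d n} → Hypergraph d n → ℕ → Set
HasHittingSet {d} {n} H k =
  Σ (Subset n) λ S → ∣ S ∣ ≤ k × All (λ e → Nonempty (S ∩ e)) (edges H)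

CorrectOut : ∀ {d n} → Hypergraph d n → ℕ → Bool → Set
CorrectOut H k out = (out ≡ true → HasHittingSet H k) × (out ≡ false → ¬ HasHittingSet H k)

GoodString : ∀ {d n r} → Hypergraph d n → ℕ → (Vec Bool r → QTree d n) → Vec Bool r → Set
GoodString H k T ρ = ∃ λ out → ∃ λ q → Exec H (T ρ) out q × CorrectOut H k out

-- Success probability ≥ 1 - 1/k^(a/b): there is a list of g distinct good random
-- strings out of 2^r with  (2^r - g)^b * k^a ≤ (2^r)^b,
-- i.e. Pr[error] ≤ (2^r - g)/2^r ≤ k^(-a/b).
SuccessProb : ∀ {d n r} → Hypergraph d n → ℕ → (Vec Bool r → QTree d n) → ℕ → ℕ → Set
SuccessProb {r = r} H k T a b =
  Σ (List (Vec Bool r)) λ good → Unique good × All (GoodString H k T) good ×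
    ((2 ^ r ∸ Data.List.length good) ^ b * k ^ a ≤ (2 ^ r) ^ b)

module Submission where

-- The algorithm runs L = 1 + ⌊log₂ k⌋ independent rounds.  A round colours
-- the vertices uniformly at random with N = 2^t colours and, for every tuple τ
-- of d distinct colours in use, asks the GPIS query whose parts are the colour
-- classes of τ.  It accepts iff some k colours meet every tuple answered "yes".
-- The algorithm accepts iff all rounds accept.
--
-- Soundness: the colours of a hitting set of size ≤ k meet every "yes" tuple,
-- so the algorithm never rejects wrongly.  Completeness rests on the kernel
-- lemma: the edges have a k-kernel X of size s ≤ (d(k+1)+1)^d, a vertex set
-- such that k vertices meeting every edge inside X meet every edge.  A round
-- whose colouring is injective on X rejects when there is no hitting set
-- (pull a covering set of colours back to X), and the colouring collides on X
-- with probability ≤ s²/N ≤ 1/2, so all L rounds fail with probability < 1/k.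
-- Each round asks ≤ N^d queries, and L·N^d = O(k^(2d²) log k).

open import Defs hiding (yes; no)
open import Data.Nat
  using (ℕ; zero; suc; _+_; _*_; _^_; _∸_; _≤_; _<_; z≤n; s≤s; _≤?_; ⌊_/2⌋; ⌈_/2⌉; NonZero; >-nonZero)
open import Data.Nat.Properties
open import Data.Nat.Logarithm using (⌊log₂_⌋; ⌊log₂⌋-mono-≤; ⌊log₂⌊n/2⌋⌋≡⌊log₂n⌋∸1; ⌊log₂[2^n]⌋≡n)
open import Data.Nat.Induction using (<-rec)
open import Data.Nat.Tactic.RingSolver using (solve-∀)
open import Data.Bool using (Bool; true; false; _∧_; _∨_; not; if_then_else_)
import Data.Bool as Bool
open import Data.Bool.Properties using (not-involutive; T-≡)
open import Data.Bool.ListAction using (any)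
open import Data.List using (List; []; _∷_; _++_; length; map; concat; concatMap; filter; filterᵇ; [_])
open import Data.List.Properties using (length-++; length-map; length-filter; filter-notAll)
open import Data.List.Membership.Propositional using (_∈_; lose; find)
open import Data.List.Membership.Propositional.Properties
  using (∈-map⁺; ∈-map⁻; ∈-filter⁺; ∈-filter⁻; ∈-++⁺ˡ; ∈-++⁺ʳ; ∈-concat⁺′; ∈-concatMap⁺)
open import Data.List.Relation.Binary.Subset.Propositional using (_⊆_)
open import Data.List.Relation.Unary.All as All using (All; []; _∷_)
open import Data.List.Relation.Unary.All.Properties using (¬All⇒Any¬)
open import Data.List.Relation.Unary.Any as Any using (Any; here; there)
open import Data.List.Relation.Unary.AllPairs using (AllPairs; []; _∷_)
open import Data.List.Relation.Unary.Unique.Propositional using (Unique)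
import Data.List.Relation.Unary.Unique.Propositional.Properties as Unique
open import Data.Vec as Vec using (Vec; []; _∷_; lookup; tabulate; toList)
import Data.Vec.Properties as Vecₚ
open import Data.Fin as Fin using (Fin; zero; suc)
import Data.Fin.Properties as Finₚ
open import Data.Fin.Subset as Subset using (Subset; inside; outside; _∩_; _∪_; ⁅_⁆; ∣_∣; Nonempty)
  renaming (_∈_ to _∈ₛ_)
import Data.Fin.Subset.Properties as Subsetₚ
open import Data.Product using (Σ; ∃; _×_; _,_; proj₁; proj₂)
open import Data.Sum using (_⊎_; inj₁; inj₂)
open import Data.Empty using (⊥-elim)
open import Function using (_∘_; Equivalence)
open import Relation.Binary.Definitions using (DecidableEquality)
open import Relation.Binary.PropositionalEquality
  using (_≡_; _≢_; refl; sym; trans; cong; cong₂; subst; subst₂; module ≡-Reasoning)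
open import Relation.Nullary using (¬_; Dec; does; yes; no; ¬?; T?)
open import Relation.Nullary.Decidable using (_×-dec_; _→-dec_; dec-true; dec-false)

private
  variable
    A B : Set

-- Counting elements of a list satisfying a boolean test, and sums over lists:
-- the finite probability spaces below are lists of equally likely outcomes.

count : (A → Bool) → List A → ℕ
count p []       = 0
count p (x ∷ xs) = if p x then suc (count p xs) else count p xs

∑ : (A → ℕ) → List A → ℕ
∑ f []       = 0
∑ f (x ∷ xs) = f x + ∑ f xs

syntax ∑ (λ x → e) xs = ∑[ x ← xs ] e

count-cong : ∀ {p q : A → Bool} → (∀ x → p x ≡ q x) → ∀ xs → count p xs ≡ count q xs
count-cong p≗q []       = refl
count-cong p≗q (x ∷ xs) rewrite p≗q x | count-cong p≗q xs = refl

count-const : ∀ b (xs : List A) → count (λ _ → b) xs ≡ (if b then length xs else 0)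
count-const true  []       = refl
count-const false []       = refl
count-const true  (x ∷ xs) = cong suc (count-const true xs)
count-const false (x ∷ xs) = count-const false xs

count-∧ˡ : ∀ b (q : A → Bool) xs → count (λ x → b ∧ q x) xs ≡ (if b then count q xs else 0)
count-∧ˡ true  q xs = refl
count-∧ˡ false q xs = count-const false xs

count-++ : ∀ (p : A → Bool) xs ys → count p (xs ++ ys) ≡ count p xs + count p ys
count-++ p []       ys = refl
count-++ p (x ∷ xs) ys with p x
... | true  = cong suc (count-++ p xs ys)
... | false = count-++ p xs ys

count-map : ∀ (p : B → Bool) (f : A → B) xs → count p (map f xs) ≡ count (p ∘ f) xs
count-map p f []       = refl
count-map p f (x ∷ xs) with p (f x)
... | true  = cong suc (count-map p f xs)
... | false = count-map p f xs

count-concatMap : ∀ (p : B → Bool) (f : A → List B) xs →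
                  count p (concatMap f xs) ≡ ∑[ x ← xs ] count p (f x)
count-concatMap p f []       = refl
count-concatMap p f (x ∷ xs) =
  trans (count-++ p (f x) (concatMap f xs)) (cong (count p (f x) +_) (count-concatMap p f xs))

count-∨ : ∀ (p q : A → Bool) xs → count (λ x → p x ∨ q x) xs ≤ count p xs + count q xs
count-∨ p q []       = z≤n
count-∨ p q (x ∷ xs) with p x | q x
... | true  | true  = s≤s (≤-trans (count-∨ p q xs) (+-monoʳ-≤ (count p xs) (n≤1+n _)))
... | true  | false = s≤s (count-∨ p q xs)
... | false | true  = ≤-trans (s≤s (count-∨ p q xs)) (≤-reflexive (sym (+-suc _ _)))
... | false | false = count-∨ p q xs

any-false : ∀ (p : A → Bool) xs {x} → any p xs ≡ false → x ∈ xs → p x ≡ false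
any-false p (y ∷ ys) h x∈ with p y in py | x∈
... | false | here refl  = py
... | false | there x∈ys = any-false p ys h x∈ys

count-any : ∀ (g : B → A → Bool) ys xs →
            count (λ x → any (λ y → g y x) ys) xs ≤ ∑[ y ← ys ] count (g y) xs
count-any g []       xs = ≤-reflexive (count-const false xs)
count-any g (y ∷ ys) xs =
  ≤-trans (count-∨ (g y) _ xs) (+-monoʳ-≤ (count (g y) xs) (count-any g ys xs))

length-filterᵇ : ∀ (p : A → Bool) xs → length (filterᵇ p xs) + count (not ∘ p) xs ≡ length xs
length-filterᵇ p []       = refl
length-filterᵇ p (x ∷ xs) with p x
... | true  = cong suc (length-filterᵇ p xs)
... | false = trans (+-suc _ _) (cong suc (length-filterᵇ p xs))

∑-cong : ∀ {f g : A → ℕ} → (∀ x → f x ≡ g x) → ∀ xs → ∑ f xs ≡ ∑ g xs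
∑-cong f≗g []       = refl
∑-cong f≗g (x ∷ xs) = cong₂ _+_ (f≗g x) (∑-cong f≗g xs)

∑-mono : ∀ {f g : A → ℕ} → (∀ x → f x ≤ g x) → ∀ xs → ∑ f xs ≤ ∑ g xs
∑-mono f≤g []       = z≤n
∑-mono f≤g (x ∷ xs) = +-mono-≤ (f≤g x) (∑-mono f≤g xs)

∑-const : ∀ m (xs : List A) → ∑[ x ← xs ] m ≡ length xs * m
∑-const m []       = refl
∑-const m (x ∷ xs) = cong (m +_) (∑-const m xs)

∑-*ʳ : ∀ (f : A → ℕ) xs m → ∑ f xs * m ≡ ∑[ x ← xs ] (f x * m)
∑-*ʳ f []       m = refl
∑-*ʳ f (x ∷ xs) m = trans (*-distribʳ-+ m (f x) _) (cong (f x * m +_) (∑-*ʳ f xs m))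

∑-if : ∀ (p : A → Bool) m xs → ∑[ x ← xs ] (if p x then m else 0) ≡ count p xs * m
∑-if p m []       = refl
∑-if p m (x ∷ xs) with p x
... | true  = cong (m +_) (∑-if p m xs)
... | false = ∑-if p m xs

length-concatMap : ∀ (f : A → List B) xs → length (concatMap f xs) ≡ ∑[ x ← xs ] length (f x)
length-concatMap f []       = refl
length-concatMap f (x ∷ xs) = trans (length-++ (f x)) (cong (length (f x) +_) (length-concatMap f xs))

-- The sample space of n independent draws from xs: all vectors over xs.
vectors : List A → (n : ℕ) → List (Vec A n)
vectors xs zero    = [ [] ]
vectors xs (suc n) = concatMap (λ a → map (a ∷_) (vectors xs n)) xs

length-vectors : ∀ (xs : List A) n → length (vectors xs n) ≡ length xs ^ n
length-vectors xs zero    = refl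
length-vectors xs (suc n) = begin
  length (vectors xs (suc n))                          ≡⟨ length-concatMap _ xs ⟩
  ∑[ a ← xs ] length (map (a ∷_) (vectors xs n))       ≡⟨ ∑-cong (λ a → length-map (a ∷_) (vectors xs n)) xs ⟩
  ∑[ a ← xs ] length (vectors xs n)                    ≡⟨ ∑-const _ xs ⟩
  length xs * length (vectors xs n)                    ≡⟨ cong (length xs *_) (length-vectors xs n) ⟩
  length xs ^ suc n                                    ∎
  where open ≡-Reasoning

∈-vectors : ∀ {xs : List A} → (∀ x → x ∈ xs) → ∀ {n} (v : Vec A n) → v ∈ vectors xs n
∈-vectors every []      = here refl
∈-vectors every (x ∷ v) = ∈-concatMap⁺ _ (lose (every x) (∈-map⁺ (x ∷_) (∈-vectors every v)))

count-vectors-suc : ∀ (xs : List A) n (p : Vec A (suc n) → Bool) →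
  count p (vectors xs (suc n)) ≡ ∑[ a ← xs ] count (λ v → p (a ∷ v)) (vectors xs n)
count-vectors-suc xs n p =
  trans (count-concatMap p _ xs) (∑-cong (λ a → count-map p (a ∷_) (vectors xs n)) xs)

allᵥ : ∀ {m} → (A → Bool) → Vec A m → Bool
allᵥ p []      = true
allᵥ p (x ∷ v) = p x ∧ allᵥ p v

allᵥ-true : ∀ {p : A → Bool} → (∀ x → p x ≡ true) → ∀ {m} (v : Vec A m) → allᵥ p v ≡ true
allᵥ-true always []      = refl
allᵥ-true always (x ∷ v) rewrite always x = allᵥ-true always v

allᵥ-mono : ∀ {p q : A → Bool} → (∀ x → p x ≡ true → q x ≡ true) →
            ∀ {m} (v : Vec A m) → allᵥ p v ≡ true → allᵥ q v ≡ true
allᵥ-mono p⇒q []      _ = refl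
allᵥ-mono {p = p} p⇒q (x ∷ v) all with p x in px
... | true rewrite p⇒q x px = allᵥ-mono p⇒q v all

count-allᵥ : ∀ (xs : List A) (p : A → Bool) m → count (allᵥ p) (vectors xs m) ≡ count p xs ^ m
count-allᵥ xs p zero    = refl
count-allᵥ xs p (suc m) = begin
  count (allᵥ p) (vectors xs (suc m))
    ≡⟨ count-vectors-suc xs m (allᵥ p) ⟩
  ∑[ a ← xs ] count (λ v → p a ∧ allᵥ p v) (vectors xs m)
    ≡⟨ ∑-cong (λ a → count-∧ˡ (p a) (allᵥ p) (vectors xs m)) xs ⟩
  ∑[ a ← xs ] (if p a then count (allᵥ p) (vectors xs m) else 0)
    ≡⟨ ∑-if p _ xs ⟩
  count p xs * count (allᵥ p) (vectors xs m)
    ≡⟨ cong (count p xs *_) (count-allᵥ xs p m) ⟩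
  count p xs ^ suc m ∎
  where open ≡-Reasoning

occurrences : DecidableEquality A → A → List A → ℕ
occurrences _≟_ c = count (λ a → does (a ≟ c))

Listing : DecidableEquality A → List A → Set
Listing _≟_ xs = ∀ c → occurrences _≟_ c xs ≡ 1

module _ (_≟_ : DecidableEquality A) where

  listing-unique : ∀ {xs} → Listing _≟_ xs → Unique xs
  listing-unique {xs} once = atMostOnce⇒Unique xs (λ c → ≤-reflexive (once c))
    where
    ∈⇒occurs : ∀ {c} xs → c ∈ xs → 1 ≤ occurrences _≟_ c xs
    ∈⇒occurs {c} (x ∷ xs) c∈ with x ≟ c | c∈
    ... | yes _ | _          = s≤s z≤n
    ... | no x≢c | here refl = ⊥-elim (x≢c refl)
    ... | no _  | there c∈xs = ∈⇒occurs xs c∈xs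
    atMostOnce⇒Unique : ∀ xs → (∀ c → occurrences _≟_ c xs ≤ 1) → Unique xs
    atMostOnce⇒Unique []       _    = []
    atMostOnce⇒Unique (x ∷ xs) once = All.tabulate x∉ ∷ atMostOnce⇒Unique xs once′
      where
      x∉ : ∀ {y} → y ∈ xs → x ≢ y
      x∉ y∈ refl with x ≟ x | once x
      ... | yes _   | s≤s h = <-irrefl refl (≤-trans (s≤s (∈⇒occurs xs y∈)) (s≤s h))
      ... | no x≢x  | _     = x≢x refl
      once′ : ∀ c → occurrences _≟_ c xs ≤ 1
      once′ c with x ≟ c | once c
      ... | yes _ | h = ≤-trans (n≤1+n _) h
      ... | no _  | h = h

  vectors-listing : ∀ {xs} → Listing _≟_ xs → ∀ n → Listing (Vecₚ.≡-dec _≟_) (vectors xs n)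
  vectors-listing once zero    [] = refl
  vectors-listing {xs} once (suc n) (c ∷ v) = begin
    occurrences′ (c ∷ v) (vectors xs (suc n))
      ≡⟨ count-vectors-suc xs n _ ⟩
    ∑[ a ← xs ] count (λ w → does (a ≟ c) ∧ does (Vecₚ.≡-dec _≟_ w v)) (vectors xs n)
      ≡⟨ ∑-cong (λ a → count-∧ˡ (does (a ≟ c)) _ (vectors xs n)) xs ⟩
    ∑[ a ← xs ] (if does (a ≟ c) then occurrences′ v (vectors xs n) else 0)
      ≡⟨ ∑-if (λ a → does (a ≟ c)) _ xs ⟩
    occurrences _≟_ c xs * occurrences′ v (vectors xs n)
      ≡⟨ cong₂ _*_ (once c) (vectors-listing once n v) ⟩
    1 ∎
    where
    open ≡-Reasoning
    occurrences′ : ∀ {m} → Vec A m → List (Vec A m) → ℕ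
    occurrences′ = occurrences (Vecₚ.≡-dec _≟_)

InjectiveOn : ∀ {n} → Vec A n → List (Fin n) → Set
InjectiveOn χ X = ∀ {x y} → x ∈ X → y ∈ X → lookup χ x ≡ lookup χ y → x ≡ y

module Collisions (_≟_ : DecidableEquality A) {cs : List A} (once : Listing _≟_ cs) where

  private
    N : ℕ
    N = length cs

  same : A → A → Bool
  same a b = does (a ≟ b)

  same-sym : ∀ a b → same a b ≡ same b a
  same-sym a b with a ≟ b | b ≟ a
  ... | yes _   | yes _   = refl
  ... | no _    | no _    = refl
  ... | yes a≡b | no b≢a  = ⊥-elim (b≢a (sym a≡b))
  ... | no a≢b  | yes b≡a = ⊥-elim (a≢b (sym b≡a))

  count-at : ∀ n (x : Fin (suc n)) c →
             count (λ χ → same (lookup χ x) c) (vectors cs (suc n)) ≡ N ^ n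
  count-at n zero c = begin
    count (λ χ → same (lookup χ zero) c) (vectors cs (suc n))
      ≡⟨ count-vectors-suc cs n _ ⟩
    ∑[ a ← cs ] count (λ _ → same a c) (vectors cs n)
      ≡⟨ ∑-cong (λ a → count-const (same a c) (vectors cs n)) cs ⟩
    ∑[ a ← cs ] (if same a c then length (vectors cs n) else 0)
      ≡⟨ ∑-if (λ a → same a c) _ cs ⟩
    occurrences _≟_ c cs * length (vectors cs n)
      ≡⟨ cong₂ _*_ (once c) (length-vectors cs n) ⟩
    1 * N ^ n
      ≡⟨ *-identityˡ _ ⟩
    N ^ n ∎
    where open ≡-Reasoning
  count-at (suc n) (suc x) c = begin
    count (λ χ → same (lookup χ (suc x)) c) (vectors cs (suc (suc n)))
      ≡⟨ count-vectors-suc cs (suc n) _ ⟩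
    ∑[ a ← cs ] count (λ χ → same (lookup χ x) c) (vectors cs (suc n))
      ≡⟨ ∑-cong (λ _ → count-at n x c) cs ⟩
    ∑[ a ← cs ] (N ^ n)
      ≡⟨ ∑-const _ cs ⟩
    N ^ suc n ∎
    where open ≡-Reasoning

  count-agree : ∀ n (x y : Fin (suc n)) → x ≢ y →
    count (λ χ → same (lookup χ x) (lookup χ y)) (vectors cs (suc n)) * N ≡ N ^ suc n
  count-agree n zero zero x≢y = ⊥-elim (x≢y refl)
  count-agree (suc n) zero (suc y) _ = begin
    count (λ χ → same (lookup χ zero) (lookup χ (suc y))) (vectors cs (suc (suc n))) * N
      ≡⟨ cong (_* N) (count-vectors-suc cs (suc n) _) ⟩
    (∑[ a ← cs ] count (λ χ → same a (lookup χ y)) (vectors cs (suc n))) * N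
      ≡⟨ cong (_* N) (∑-cong (λ a → trans (count-cong (λ χ → same-sym a (lookup χ y)) (vectors cs (suc n)))
                                          (count-at n y a)) cs) ⟩
    (∑[ a ← cs ] (N ^ n)) * N
      ≡⟨ cong (_* N) (∑-const _ cs) ⟩
    N ^ suc n * N
      ≡⟨ *-comm _ N ⟩
    N ^ suc (suc n) ∎
    where open ≡-Reasoning
  count-agree (suc n) (suc x) zero x≢y =
    trans (cong (_* N) (count-cong (λ χ → same-sym (lookup χ (suc x)) (lookup χ zero))
                                   (vectors cs (suc (suc n)))))
          (count-agree (suc n) zero (suc x) (x≢y ∘ sym))
  count-agree (suc n) (suc x) (suc y) x≢y = begin
    count (λ χ → same (lookup χ (suc x)) (lookup χ (suc y))) (vectors cs (suc (suc n))) * N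
      ≡⟨ cong (_* N) (count-vectors-suc cs (suc n) _) ⟩
    (∑[ a ← cs ] agree) * N
      ≡⟨ cong (_* N) (∑-const _ cs) ⟩
    N * agree * N
      ≡⟨ *-assoc N agree N ⟩
    N * (agree * N)
      ≡⟨ cong (N *_) (count-agree n x y (x≢y ∘ cong suc)) ⟩
    N ^ suc (suc n) ∎
    where
    open ≡-Reasoning
    agree : ℕ
    agree = count (λ χ → same (lookup χ x) (lookup χ y)) (vectors cs (suc n))

  clash : ∀ {n} → Vec A n → Fin n → Fin n → Bool
  clash χ x y = not (does (x Fin.≟ y)) ∧ same (lookup χ x) (lookup χ y)

  count-clash : ∀ {n} (x y : Fin n) → count (λ χ → clash χ x y) (vectors cs n) * N ≤ N ^ n
  count-clash {suc n} x y with x Fin.≟ y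
  ... | yes _   = ≤-trans (≤-reflexive (cong (_* N) (count-const false (vectors cs (suc n))))) z≤n
  ... | no x≢y  = ≤-reflexive (count-agree n x y x≢y)

  collides : ∀ {n} → List (Fin n) → Vec A n → Bool
  collides X χ = any (λ x → any (clash χ x) X) X

  -- Union bound over the |X|² pairs: χ collides on X with probability ≤ |X|²/N.
  count-collides : ∀ {n} (X : List (Fin n)) →
                   count (collides X) (vectors cs n) * N ≤ length X * (length X * N ^ n)
  count-collides {n} X = begin
    count (collides X) (vectors cs n) * N
      ≤⟨ *-monoˡ-≤ N (≤-trans (count-any (λ x χ → any (clash χ x) X) X (vectors cs n))
                              (∑-mono (λ x → count-any (λ y χ → clash χ x y) X (vectors cs n)) X)) ⟩
    (∑[ x ← X ] ∑[ y ← X ] count (λ χ → clash χ x y) (vectors cs n)) * N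
      ≡⟨ trans (∑-*ʳ _ X N) (∑-cong (λ x → ∑-*ʳ _ X N) X) ⟩
    ∑[ x ← X ] ∑[ y ← X ] (count (λ χ → clash χ x y) (vectors cs n) * N)
      ≤⟨ ∑-mono (λ x → ∑-mono (λ y → count-clash x y) X) X ⟩
    ∑[ x ← X ] ∑[ y ← X ] (N ^ n)
      ≡⟨ trans (∑-cong (λ x → ∑-const _ X) X) (∑-const _ X) ⟩
    length X * (length X * N ^ n) ∎
    where open ≤-Reasoning

  injective-on : ∀ {n} (X : List (Fin n)) (χ : Vec A n) → collides X χ ≡ false → InjectiveOn χ X
  injective-on X χ noClash {x} {y} x∈ y∈ χx≡χy
    with x Fin.≟ y | lookup χ x ≟ lookup χ y | any-false (clash χ x) X (any-false _ X noClash x∈) y∈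
  ... | yes x≡y | _        | _  = x≡y
  ... | no _    | no χx≢χy | _  = ⊥-elim (χx≢χy χx≡χy)
  ... | no _    | yes _    | ()

-- Sets are represented by lists.
module Kernel {V : Set} (_≟_ : DecidableEquality V) where

  open import Data.List.Membership.DecPropositional _≟_ using (_∈?_)

  Meets : List V → List V → Set
  Meets T e = Any (_∈ T) e

  meets? : ∀ T e → Dec (Meets T e)
  meets? T = Any.any? (_∈? T)

  Disjoint : List V → List V → Set
  Disjoint a b = ¬ Meets a b

  length-concat : ∀ j (M : List (List V)) → (∀ {e} → e ∈ M → length e ≤ j) →
                  length (concat M) ≤ length M * j
  length-concat j []      _     = z≤n
  length-concat j (e ∷ M) short =
    ≤-trans (≤-reflexive (length-++ e)) (+-mono-≤ (short (here refl)) (length-concat j M (short ∘ there)))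

  -- Greedy packing: either m pairwise disjoint members of F, or a set of
  -- size ≤ m·j (the union of fewer disjoint members) meeting every member of F.
  packing-or-cover : ∀ j F → (∀ {e} → e ∈ F → length e ≤ j) → ∀ m →
      (Σ (List (List V)) λ M → length M ≡ m × M ⊆ F × AllPairs Disjoint M)
    ⊎ (Σ (List V) λ Y → length Y ≤ m * j × All (Meets Y) F)
  packing-or-cover j F short zero = inj₁ ([] , refl , (λ ()) , [])
  packing-or-cover j F short (suc m) with packing-or-cover j F short m
  ... | inj₂ (Y , |Y| , covers) = inj₂ (Y , ≤-trans |Y| (*-monoˡ-≤ j (n≤1+n m)) , covers)
  ... | inj₁ (M , |M| , M⊆F , disjoint) with All.all? (meets? (concat M)) F
  ...   | yes covers = inj₂ (concat M , |⋃M| , covers)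
    where
    |⋃M| : length (concat M) ≤ suc m * j
    |⋃M| = ≤-trans (length-concat j M (short ∘ M⊆F))
                         (≤-trans (≤-reflexive (cong (_* j) |M|)) (*-monoˡ-≤ j (n≤1+n m)))
  ...   | no ¬covers with find (¬All⇒Any¬ (meets? (concat M)) F ¬covers)
  ...     | (e , e∈F , misses) =
    inj₁ (e ∷ M , cong suc |M| , e∷M⊆F , All.tabulate e-disjoint ∷ disjoint)
    where
    e∷M⊆F : e ∷ M ⊆ F
    e∷M⊆F (here refl) = e∈F
    e∷M⊆F (there f∈M) = M⊆F f∈M
    e-disjoint : ∀ {f} → f ∈ M → Disjoint e f
    e-disjoint f∈M meet with find meet
    ... | (v , v∈f , v∈e) = misses (lose v∈e (∈-concat⁺′ v∈f f∈M))

  remove : V → List V → List V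
  remove y = filter (λ v → ¬? (v ≟ y))

  length-remove : ∀ {y} e → y ∈ e → length (remove y e) < length e
  length-remove {y} e y∈e = filter-notAll (λ v → ¬? (v ≟ y)) e (Any.map (λ y≡v v≢y → v≢y (sym y≡v)) y∈e)

  ∈-remove⁺ : ∀ {y v e} → v ∈ e → v ≢ y → v ∈ remove y e
  ∈-remove⁺ {y} = ∈-filter⁺ (λ v → ¬? (v ≟ y))

  ∈-remove⁻ : ∀ {y v e} → v ∈ remove y e → v ∈ e
  ∈-remove⁻ {y} {e = e} = proj₁ ∘ ∈-filter⁻ (λ v → ¬? (v ≟ y)) {xs = e}

  disjoint-met : ∀ M T → AllPairs Disjoint M → All (Meets T) M → length M ≤ length T
  disjoint-met []      T _                     _                = z≤n
  disjoint-met (e ∷ M) T (e-disjoint ∷ disjoint) (meet ∷ meets) with find meet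
  ... | (v , v∈e , v∈T) =
    ≤-trans (s≤s (disjoint-met M (remove v T) disjoint (All.tabulate meets′))) (length-remove T v∈T)
    where
    meets′ : ∀ {f} → f ∈ M → Meets (remove v T) f
    meets′ {f} f∈M with find (All.lookup meets f∈M)
    ... | (w , w∈f , w∈T) = lose w∈f (∈-remove⁺ w∈T w≢v)
      where
      w≢v : w ≢ v
      w≢v refl = All.lookup e-disjoint f∈M (lose w∈f v∈e)

  link : V → List (List V) → List (List V)
  link y F = map (remove y) (filter (y ∈?_) F)

  ∈-link⁺ : ∀ {y e F} → e ∈ F → y ∈ e → remove y e ∈ link y F
  ∈-link⁺ {y} e∈F y∈e = ∈-map⁺ (remove y) (∈-filter⁺ (y ∈?_) e∈F y∈e)

  ∈-link⁻ : ∀ {y f F} → f ∈ link y F → ∃ λ e → e ∈ F × y ∈ e × f ≡ remove y e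
  ∈-link⁻ {y} {F = F} f∈ with ∈-map⁻ (remove y) f∈
  ... | (e , e∈ , refl) with ∈-filter⁻ (y ∈?_) {xs = F} e∈
  ...   | (e∈F , y∈e) = e , e∈F , y∈e , refl

  IsKernel : ℕ → List (List V) → List V → Set
  IsKernel k F X = ∀ T → length T ≤ k → (∀ {e} → e ∈ F → e ⊆ X → Meets T e) →
                   ∀ {e} → e ∈ F → Meets T e

  -- k+1 pairwise disjoint members of F cannot all be met by k points, so their
  -- union is (vacuously) a k-kernel.
  packing-kernel : ∀ k F M → length M ≡ suc k → M ⊆ F → AllPairs Disjoint M → IsKernel k F (concat M)
  packing-kernel k F M |M| M⊆F disjoint T |T| met =
    ⊥-elim (<-irrefl refl (≤-trans (≤-reflexive (sym |M|)) (≤-trans pigeon |T|)))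
    where
    pigeon : length M ≤ length T
    pigeon = disjoint-met M T disjoint (All.tabulate (λ e∈M → met (M⊆F e∈M) (λ v∈e → ∈-concat⁺′ v∈e e∈M)))

  -- If Y meets every member of F and Xs y is a k-kernel of the link of y,
  -- then Y together with all the Xs y is a k-kernel of F: a member e meets Y
  -- in some y; either y ∈ T, or T meets e ∖ y by the kernel property of Xs y.
  cover-kernel : ∀ k F Y (Xs : V → List V) → All (Meets Y) F →
                 (∀ y → IsKernel k (link y F) (Xs y)) → IsKernel k F (Y ++ concatMap Xs Y)
  cover-kernel k F Y Xs covers kernels T |T| met {e} e∈F with find (All.lookup covers e∈F)
  ... | (y , y∈e , y∈Y) with y ∈? T
  ...   | yes y∈T = lose y∈e y∈T
  ...   | no y∉T  = meets-e∖y
    where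
    X : List V
    X = Y ++ concatMap Xs Y
    met-link : ∀ {f} → f ∈ link y F → f ⊆ Xs y → Meets T f
    met-link f∈ f⊆ with ∈-link⁻ f∈
    ... | (e′ , e′∈F , y∈e′ , refl) with find (met e′∈F e′⊆X)
      where
      e′⊆X : e′ ⊆ X
      e′⊆X {v} v∈e′ with v ≟ y
      ... | yes refl = ∈-++⁺ˡ y∈Y
      ... | no v≢y   = ∈-++⁺ʳ Y (∈-concatMap⁺ Xs (lose y∈Y (f⊆ (∈-remove⁺ v∈e′ v≢y))))
    ... | (w , w∈e′ , w∈T) = lose (∈-remove⁺ w∈e′ (λ { refl → y∉T w∈T })) w∈T
    meets-e∖y : Meets T e
    meets-e∖y with find (kernels y T |T| met-link (∈-link⁺ e∈F y∈e))
    ... | (w , w∈e∖y , w∈T) = lose (∈-remove⁻ w∈e∖y) w∈T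

  kernelSize : ℕ → ℕ → ℕ
  kernelSize A zero    = 0
  kernelSize A (suc j) = A + A * kernelSize A j

  -- The kernel lemma: induction on the size bound j, using a greedy packing of
  -- k+1 disjoint members, or else a small cover Y and kernels of the links.
  kernel : ∀ j k A → j * suc k ≤ A → ∀ F → (∀ {e} → e ∈ F → length e ≤ j) →
           Σ (List V) λ X → length X ≤ kernelSize A j × IsKernel k F X
  kernel zero k A _ F short = [] , z≤n , λ T _ met e∈F → met e∈F (empty (short e∈F))
    where
    empty : ∀ {e} → length e ≤ 0 → e ⊆ []
    empty {[]} _ ()
  kernel (suc j) k A j+1≤A F short with packing-or-cover (suc j) F short (suc k)
  ... | inj₁ (M , |M| , M⊆F , disjoint) =
    concat M , |⋃M| , packing-kernel k F M |M| M⊆F disjoint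
    where
    |⋃M| : length (concat M) ≤ A + A * kernelSize A j
    |⋃M| = begin
      length (concat M)  ≤⟨ length-concat (suc j) M (short ∘ M⊆F) ⟩
      length M * suc j   ≡⟨ trans (cong (_* suc j) |M|) (*-comm (suc k) (suc j)) ⟩
      suc j * suc k      ≤⟨ j+1≤A ⟩
      A                  ≤⟨ m≤m+n A _ ⟩
      A + A * kernelSize A j ∎
      where open ≤-Reasoning
  ... | inj₂ (Y , |Y| , covers) =
    Y ++ concatMap Xs Y , |X| , cover-kernel k F Y Xs covers (λ y → proj₂ (proj₂ (linkKernel y)))
    where
    j≤A : j * suc k ≤ A
    j≤A = ≤-trans (*-monoˡ-≤ (suc k) (n≤1+n j)) j+1≤A
    short-link : ∀ y {f} → f ∈ link y F → length f ≤ j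
    short-link y f∈ with ∈-link⁻ f∈
    ... | (e , e∈F , y∈e , refl) = ≤-pred (≤-trans (length-remove e y∈e) (short e∈F))
    linkKernel : ∀ y → Σ (List V) λ X → length X ≤ kernelSize A j × IsKernel k (link y F) X
    linkKernel y = kernel j k A j≤A (link y F) (short-link y)
    Xs : V → List V
    Xs y = proj₁ (linkKernel y)
    |Y|≤A : length Y ≤ A
    |Y|≤A = ≤-trans |Y| (≤-trans (≤-reflexive (*-comm (suc k) (suc j))) j+1≤A)
    |X| : length (Y ++ concatMap Xs Y) ≤ A + A * kernelSize A j
    |X| = begin
      length (Y ++ concatMap Xs Y)             ≡⟨ length-++ Y ⟩
      length Y + length (concatMap Xs Y)       ≡⟨ cong (length Y +_) (length-concatMap Xs Y) ⟩
      length Y + ∑[ y ← Y ] length (Xs y)      ≤⟨ +-monoʳ-≤ (length Y) (∑-mono (proj₁ ∘ proj₂ ∘ linkKernel) Y) ⟩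
      length Y + ∑[ y ← Y ] kernelSize A j     ≡⟨ cong (length Y +_) (∑-const _ Y) ⟩
      length Y + length Y * kernelSize A j     ≤⟨ +-mono-≤ |Y|≤A (*-monoˡ-≤ _ |Y|≤A) ⟩
      A + A * kernelSize A j ∎
      where open ≤-Reasoning

  kernelSize< : ∀ A j → kernelSize A j < suc A ^ j
  kernelSize< A zero    = s≤s z≤n
  kernelSize< A (suc j) = begin-strict
    A + A * kernelSize A j       <⟨ s≤s (≤-reflexive (sym (*-suc A (kernelSize A j)))) ⟩
    suc (A * suc (kernelSize A j)) ≤⟨ s≤s (m≤n+m _ (kernelSize A j)) ⟩
    suc A * suc (kernelSize A j)   ≤⟨ *-monoʳ-≤ (suc A) (kernelSize< A j) ⟩
    suc A ^ suc j ∎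
    where open ≤-Reasoning

elements : ∀ {n} → Subset n → List (Fin n)
elements []            = []
elements (inside ∷ p)  = zero ∷ map suc (elements p)
elements (outside ∷ p) = map suc (elements p)

length-elements : ∀ {n} (p : Subset n) → length (elements p) ≡ ∣ p ∣
length-elements []            = refl
length-elements (inside ∷ p)  = cong suc (trans (length-map suc (elements p)) (length-elements p))
length-elements (outside ∷ p) = trans (length-map suc (elements p)) (length-elements p)

∈-elements⁺ : ∀ {n} {x : Fin n} {p} → x ∈ₛ p → x ∈ elements p
∈-elements⁺ {p = inside ∷ p}                Vec.here      = here refl
∈-elements⁺ {x = suc x} {p = inside ∷ p}    (Vec.there m) = there (∈-map⁺ suc (∈-elements⁺ m))
∈-elements⁺ {x = suc x} {p = outside ∷ p}   (Vec.there m) = ∈-map⁺ suc (∈-elements⁺ m)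

∈-elements⁻ : ∀ {n} {x : Fin n} {p} → x ∈ elements p → x ∈ₛ p
∈-elements⁻ {p = inside ∷ p} (here refl) = Vec.here
∈-elements⁻ {p = inside ∷ p} (there m) with ∈-map⁻ suc m
... | (y , y∈ , refl) = Vec.there (∈-elements⁻ y∈)
∈-elements⁻ {p = outside ∷ p} m with ∈-map⁻ suc m
... | (y , y∈ , refl) = Vec.there (∈-elements⁻ y∈)

elements-unique : ∀ {n} (p : Subset n) → Unique (elements p)
elements-unique []            = []
elements-unique (inside ∷ p)  = All.tabulate zero∉ ∷ Unique.map⁺ Finₚ.suc-injective (elements-unique p)
  where
  zero∉ : ∀ {y} → y ∈ map suc (elements p) → zero ≢ y
  zero∉ y∈ refl with ∈-map⁻ suc y∈
  ... | (_ , _ , ())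
elements-unique (outside ∷ p) = Unique.map⁺ Finₚ.suc-injective (elements-unique p)

∣p∪q∣≤∣p∣+∣q∣ : ∀ {n} (p q : Subset n) → ∣ p ∪ q ∣ ≤ ∣ p ∣ + ∣ q ∣
∣p∪q∣≤∣p∣+∣q∣ []            []            = z≤n
∣p∪q∣≤∣p∣+∣q∣ (inside ∷ p)  (inside ∷ q)  = s≤s (≤-trans (∣p∪q∣≤∣p∣+∣q∣ p q) (+-monoʳ-≤ ∣ p ∣ (n≤1+n _)))
∣p∪q∣≤∣p∣+∣q∣ (inside ∷ p)  (outside ∷ q) = s≤s (∣p∪q∣≤∣p∣+∣q∣ p q)
∣p∪q∣≤∣p∣+∣q∣ (outside ∷ p) (inside ∷ q)  = ≤-trans (s≤s (∣p∪q∣≤∣p∣+∣q∣ p q)) (≤-reflexive (sym (+-suc _ _)))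
∣p∪q∣≤∣p∣+∣q∣ (outside ∷ p) (outside ∷ q) = ∣p∪q∣≤∣p∣+∣q∣ p q

fromList : ∀ {n} → List (Fin n) → Subset n
fromList []      = Subset.⊥
fromList (x ∷ T) = ⁅ x ⁆ ∪ fromList T

∣fromList∣≤length : ∀ {n} (T : List (Fin n)) → ∣ fromList T ∣ ≤ length T
∣fromList∣≤length {n} [] = ≤-reflexive (Subsetₚ.∣⊥∣≡0 n)
∣fromList∣≤length (x ∷ T) = begin
  ∣ ⁅ x ⁆ ∪ fromList T ∣        ≤⟨ ∣p∪q∣≤∣p∣+∣q∣ ⁅ x ⁆ (fromList T) ⟩
  ∣ ⁅ x ⁆ ∣ + ∣ fromList T ∣    ≡⟨ cong (_+ ∣ fromList T ∣) (Subsetₚ.∣⁅x⁆∣≡1 x) ⟩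
  suc ∣ fromList T ∣            ≤⟨ s≤s (∣fromList∣≤length T) ⟩
  suc (length T)                ∎
  where open ≤-Reasoning

∈-fromList : ∀ {n} {x : Fin n} {T} → x ∈ T → x ∈ₛ fromList T
∈-fromList {T = y ∷ T} (here refl) = Subsetₚ.x∈p∪q⁺ (inj₁ (Subsetₚ.x∈⁅x⁆ y))
∈-fromList {T = y ∷ T} (there x∈T) = Subsetₚ.x∈p∪q⁺ (inj₂ (∈-fromList x∈T))

enumerate : ∀ {V : Set} (l : List V) d → length l ≡ d → Unique l →
  Σ (Fin d → V) λ u → (∀ i → u i ∈ l) × (∀ {v} → v ∈ l → ∃ λ i → u i ≡ v) × (∀ i j → u i ≡ u j → i ≡ j)
enumerate []      zero    refl _ = (λ ()) , (λ ()) , (λ ()) , (λ ())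
enumerate {V} (x ∷ l) (suc d) |l| (x∉l ∷ unique) with enumerate l d (suc-injective |l|) unique
... | (u , u∈ , onto , injective) = u′ , u′∈ , onto′ , injective′
  where
  u′ : Fin (suc d) → V
  u′ zero    = x
  u′ (suc i) = u i
  u′∈ : ∀ i → u′ i ∈ x ∷ l
  u′∈ zero    = here refl
  u′∈ (suc i) = there (u∈ i)
  onto′ : ∀ {v} → v ∈ x ∷ l → ∃ λ i → u′ i ≡ v
  onto′ (here refl) = zero , refl
  onto′ (there v∈l) = let (i , ui≡v) = onto v∈l in suc i , ui≡v
  injective′ : ∀ i j → u′ i ≡ u′ j → i ≡ j
  injective′ zero    zero    _   = refl
  injective′ zero    (suc j) x≡u = ⊥-elim (All.lookup x∉l (u∈ j) x≡u)
  injective′ (suc i) zero    u≡x = ⊥-elim (All.lookup x∉l (u∈ i) (sym u≡x))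
  injective′ (suc i) (suc j) u≡u = cong suc (injective i j u≡u)

∃-function? : ∀ {n} m (P : (Fin m → Fin n) → Set) → (∀ u → Dec (P u)) →
              (∀ {u u′} → (∀ i → u i ≡ u′ i) → P u → P u′) → Dec (Σ (Fin m → Fin n) P)
∃-function? zero P P? resp with P? (λ ())
... | yes p = yes (_ , p)
... | no ¬p = no λ (u , pu) → ¬p (resp (λ ()) pu)
∃-function? {n} (suc m) P P? resp
  with Finₚ.any? (λ a → ∃-function? m (P ∘ cons a) (P? ∘ cons a) (resp ∘ cons-cong a))
  where
  cons : Fin n → (Fin m → Fin n) → Fin (suc m) → Fin n
  cons a u zero    = a
  cons a u (suc i) = u i
  cons-cong : ∀ a {u u′} → (∀ i → u i ≡ u′ i) → ∀ i → cons a u i ≡ cons a u′ i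
  cons-cong a u≗u′ zero    = refl
  cons-cong a u≗u′ (suc i) = u≗u′ i
... | yes (a , u , p) = yes (_ , p)
... | no ¬p = no λ (u , pu) → ¬p (u zero , u ∘ suc , resp (λ { zero → refl ; (suc i) → refl }) pu)

-- The predicates of the problem are decidable; in particular the GPIS oracle
-- can be simulated, which is how runs of a query algorithm are constructed.
edgeFits? : ∀ {d n} (A : Query d n) (e : Subset n) → Dec (EdgeFits A e)
edgeFits? {d} {n} A e = ∃-function? d Fits fits? resp
  where
  Fits : (Fin d → Fin n) → Set
  Fits u = (∀ i → u i ∈ₛ A i) × (∀ v → (v ∈ₛ e → ∃ λ i → u i ≡ v) × (∃ (λ i → u i ≡ v) → v ∈ₛ e))
  hit? : ∀ u v → Dec (∃ λ i → u i ≡ v)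
  hit? u v = Finₚ.any? (λ i → u i Fin.≟ v)
  fits? : ∀ u → Dec (Fits u)
  fits? u = Finₚ.all? (λ i → u i Subsetₚ.∈? A i)
      ×-dec Finₚ.all? (λ v → ((v Subsetₚ.∈? e) →-dec hit? u v) ×-dec (hit? u v →-dec (v Subsetₚ.∈? e)))
  resp : ∀ {u u′} → (∀ i → u i ≡ u′ i) → Fits u → Fits u′
  resp u≗u′ (u∈A , image) =
    (λ i → subst (_∈ₛ A i) (u≗u′ i) (u∈A i)) ,
    λ v → (λ v∈e → let (i , ui≡v) = proj₁ (image v) v∈e in i , trans (sym (u≗u′ i)) ui≡v) ,
          (λ (i , u′i≡v) → proj₂ (image v) (i , trans (u≗u′ i) u′i≡v))

gpis? : ∀ {d n} (H : Hypergraph d n) (A : Query d n) → Dec (GPIS H A)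
gpis? H A = Any.any? (edgeFits? A) (edges H)

hittingSet? : ∀ {d n} (H : Hypergraph d n) k → Dec (HasHittingSet H k)
hittingSet? H k =
  Subsetₚ.anySubset? (λ S → (∣ S ∣ ≤? k) ×-dec All.all? (λ e → Subsetₚ.nonempty? (S ∩ e)) (edges H))

module _ {d n : ℕ} where

  askAll : ∀ {X : Set} → (X → Query d n) → List X → (List X → QTree d n) → QTree d n
  askAll q []       k = k []
  askAll q (x ∷ xs) k = query (q x) (askAll q xs (k ∘ (x ∷_))) (askAll q xs k)

  askAll-exec : ∀ (H : Hypergraph d n) {X : Set} (q : X → Query d n) xs → All (ValidQuery ∘ q) xs →
                ∀ {k out m} → Exec H (k (filter (gpis? H ∘ q) xs)) out m →
                Exec H (askAll q xs k) out (length xs + m)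
  askAll-exec H q []       []                run = run
  askAll-exec H q (x ∷ xs) (valid ∷ valids) run with gpis? H (q x)
  ... | yes g = step valid (Answer.yes g) (askAll-exec H q xs valids run)
  ... | no ¬g = step valid (Answer.no ¬g) (askAll-exec H q xs valids run)

  Test : Set
  Test = (Bool → QTree d n) → QTree d n

  Computes : Hypergraph d n → Test → Bool → ℕ → Set
  Computes H t b cost = ∀ {k out m} → Exec H (k b) out m → Exec H (t k) out (cost + m)

  allTests : ∀ {X : Set} {m} → (X → Test) → Vec X m → QTree d n
  allTests test []       = leaf true
  allTests test (x ∷ xs) = test x (λ b → if b then allTests test xs else leaf false)

  allTests-exec : ∀ (H : Hypergraph d n) {X : Set} (test : X → Test) (ok : X → Bool) B →
                  (∀ x → ∃ λ cost → cost ≤ B × Computes H (test x) (ok x) cost) →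
                  ∀ {m} (xs : Vec X m) → ∃ λ q → Exec H (allTests test xs) (allᵥ ok xs) q × q ≤ m * B
  allTests-exec H test ok B computes [] = 0 , done true , z≤n
  allTests-exec H test ok B computes (x ∷ xs) with ok x | computes x
  ... | true  | (cost , cost≤B , run) =
    let (q , exec , q≤) = allTests-exec H test ok B computes xs
    in cost + q , run exec , +-mono-≤ cost≤B q≤
  ... | false | (cost , cost≤B , run) =
    cost + 0 , run (done false) , ≤-trans (≤-reflexive (+-identityʳ cost)) (≤-trans cost≤B (m≤m+n B _))

-- Colours are bit strings of length t, drawn uniformly at random.
Colour : ℕ → Set
Colour t = Vec Bool t

_≟ᶜ_ : ∀ {t} → DecidableEquality (Colour t)
_≟ᶜ_ = Vecₚ.≡-dec Bool._≟_

bits : List Bool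
bits = true ∷ false ∷ []

colours : ∀ t → List (Colour t)
colours t = vectors bits t

colours-listing : ∀ t → Listing _≟ᶜ_ (colours t)
colours-listing = vectors-listing Bool._≟_ λ { true → refl ; false → refl }

∈-colours : ∀ {t} (c : Colour t) → c ∈ colours t
∈-colours = ∈-vectors λ { true → here refl ; false → there (here refl) }

pad : ∀ {m} (l : List A) → length l ≤ m → A → Vec A m
pad {m = m} []      _         a = Vec.replicate m a
pad         (x ∷ l) (s≤s |l|) a = x ∷ pad l |l| a

∈-pad : ∀ {m} (l : List A) (|l| : length l ≤ m) a {x} → x ∈ l → x ∈ toList (pad l |l| a)
∈-pad (y ∷ l) (s≤s |l|) a (here x≡y) = here x≡y
∈-pad (y ∷ l) (s≤s |l|) a (there x∈l) = there (∈-pad l |l| a x∈l)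

does-true : ∀ {P : Set} (p? : Dec P) → does p? ≡ true → P
does-true (yes p) _ = p

module ColourCoding {d n t : ℕ} (k : ℕ) where

  open Kernel (Fin._≟_ {n}) using (Meets; IsKernel)
  open import Data.List.Membership.DecPropositional (_≟ᶜ_ {t}) using () renaming (_∈?_ to _∈ᶜ?_)

  Colouring : Set
  Colouring = Vec (Colour t) n

  Tuple : Set
  Tuple = Vec (Colour t) d

  class : Colouring → Colour t → Subset n
  class χ c = tabulate (λ v → does (lookup χ v ≟ᶜ c))

  ∈-class⁺ : ∀ χ {v c} → lookup χ v ≡ c → v ∈ₛ class χ c
  ∈-class⁺ χ {v} {c} χv≡c =
    Vecₚ.lookup⇒[]= v (class χ c) (trans (Vecₚ.lookup∘tabulate _ v) (dec-true (lookup χ v ≟ᶜ c) χv≡c))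

  ∈-class⁻ : ∀ χ {v c} → v ∈ₛ class χ c → lookup χ v ≡ c
  ∈-class⁻ χ {v} {c} v∈ =
    does-true (lookup χ v ≟ᶜ c) (trans (sym (Vecₚ.lookup∘tabulate _ v)) (Vecₚ.[]=⇒lookup v∈))

  colourQuery : Colouring → Tuple → Query d n
  colourQuery χ τ i = class χ (lookup τ i)

  ValidTuple : Colouring → Tuple → Set
  ValidTuple χ τ = (∀ i → ∃ λ v → lookup χ v ≡ lookup τ i) × (∀ i j → i ≢ j → lookup τ i ≢ lookup τ j)

  validTuple? : ∀ χ τ → Dec (ValidTuple χ τ)
  validTuple? χ τ =
    Finₚ.all? (λ i → Finₚ.any? (λ v → lookup χ v ≟ᶜ lookup τ i))
    ×-dec Finₚ.all? (λ i → Finₚ.all? (λ j → ¬? (i Fin.≟ j) →-dec ¬? (lookup τ i ≟ᶜ lookup τ j)))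

  valid-query : ∀ {χ τ} → ValidTuple χ τ → ValidQuery (colourQuery χ τ)
  valid-query {χ} {τ} (used , distinct) = nonempty , disjoint
    where
    nonempty : ∀ i → Nonempty (colourQuery χ τ i)
    nonempty i = let (v , χv≡τi) = used i in v , ∈-class⁺ χ χv≡τi
    disjoint : ∀ i j → i ≢ j → Subset.Empty (colourQuery χ τ i ∩ colourQuery χ τ j)
    disjoint i j i≢j (v , v∈) with Subsetₚ.x∈p∩q⁻ _ _ v∈
    ... | (v∈i , v∈j) = distinct i j i≢j (trans (sym (∈-class⁻ χ v∈i)) (∈-class⁻ χ v∈j))

  validTuples : Colouring → List Tuple
  validTuples χ = filter (validTuple? χ) (vectors (colours t) d)

  Covers : List (Colour t) → Tuple → Set
  Covers C τ = ∃ λ i → lookup τ i ∈ C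

  candidates : List (List (Colour t))
  candidates = map toList (vectors (colours t) k)

  Coverable : List Tuple → Set
  Coverable Y = Any (λ C → All (Covers C) Y) candidates

  coverable? : ∀ Y → Dec (Coverable Y)
  coverable? Y = Any.any? (λ C → All.all? (λ τ → Finₚ.any? (λ i → lookup τ i ∈ᶜ? C)) Y) candidates

  roundTest : Colouring → Test
  roundTest χ next = askAll (colourQuery χ) (validTuples χ) (λ Y → next (does (coverable? Y)))

  firstOfColour : Colouring → List (Fin n) → Colour t → List (Fin n)
  firstOfColour χ []      c = []
  firstOfColour χ (x ∷ X) c = if does (lookup χ x ≟ᶜ c) then [ x ] else firstOfColour χ X c

  length-firstOfColour : ∀ χ X c → length (firstOfColour χ X c) ≤ 1
  length-firstOfColour χ []      c = z≤n
  length-firstOfColour χ (x ∷ X) c with lookup χ x ≟ᶜ c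
  ... | yes _ = s≤s z≤n
  ... | no _  = length-firstOfColour χ X c

  firstOfColour-∈ : ∀ χ {X x} → x ∈ X →
                    ∃ λ y → y ∈ firstOfColour χ X (lookup χ x) × y ∈ X × lookup χ y ≡ lookup χ x
  firstOfColour-∈ χ {y ∷ X} {x} x∈ with lookup χ y ≟ᶜ lookup χ x | x∈
  ... | yes χy≡χx | _          = y , here refl , here refl , χy≡χx
  ... | no χy≢χx  | here refl  = ⊥-elim (χy≢χx refl)
  ... | no _      | there x∈X  =
    let (z , z∈ , z∈X , χz≡χx) = firstOfColour-∈ χ x∈X in z , z∈ , there z∈X , χz≡χx

  pullback : Colouring → List (Fin n) → List (Colour t) → List (Fin n)
  pullback χ X = concatMap (firstOfColour χ X)

  length-pullback : ∀ χ X C → length (pullback χ X C) ≤ length C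
  length-pullback χ X C = begin
    length (pullback χ X C)                     ≡⟨ length-concatMap (firstOfColour χ X) C ⟩
    ∑[ c ← C ] length (firstOfColour χ X c)     ≤⟨ ∑-mono (length-firstOfColour χ X) C ⟩
    ∑[ c ← C ] 1                                ≡⟨ ∑-const 1 C ⟩
    length C * 1                                ≡⟨ *-identityʳ _ ⟩
    length C                                    ∎
    where open ≤-Reasoning

  ∈-pullback : ∀ {χ X C x} → InjectiveOn χ X → x ∈ X → lookup χ x ∈ C → x ∈ pullback χ X C
  ∈-pullback {χ} {X} injective x∈X χx∈C with firstOfColour-∈ χ x∈X
  ... | (y , y∈ , y∈X , χy≡χx) with injective y∈X x∈X χy≡χx
  ... | refl = ∈-concatMap⁺ (firstOfColour χ X) (lose χx∈C y∈)

  module _ (H : Hypergraph d n) where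

    yesTuples : Colouring → List Tuple
    yesTuples χ = filter (gpis? H ∘ colourQuery χ) (validTuples χ)

    roundOK : Colouring → Bool
    roundOK χ = does (coverable? (yesTuples χ))

    round-computes : ∀ χ → ∃ λ cost → cost ≤ length (colours t) ^ d × Computes H (roundTest χ) (roundOK χ) cost
    round-computes χ =
      length (validTuples χ) , |valid| , askAll-exec H (colourQuery χ) (validTuples χ) (All.tabulate legal)
      where
      |valid| : length (validTuples χ) ≤ length (colours t) ^ d
      |valid| = ≤-trans (length-filter (validTuple? χ) (vectors (colours t) d))
                        (≤-reflexive (length-vectors (colours t) d))
      legal : ∀ {τ} → τ ∈ validTuples χ → ValidQuery (colourQuery χ τ)
      legal {τ} τ∈ = valid-query {χ} {τ} (proj₂ (∈-filter⁻ (validTuple? χ) {xs = vectors (colours t) d} τ∈))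

    -- Soundness: the colours of a hitting set of size ≤ k cover every "yes" tuple.
    round-sound : HasHittingSet H k → ∀ χ → roundOK χ ≡ true
    round-sound (S , |S| , hits) χ = dec-true (coverable? (yesTuples χ)) (lose C∈ (All.tabulate covers))
      where
      |χS| : length (map (lookup χ) (elements S)) ≤ k
      |χS| = subst (_≤ k) (sym (trans (length-map _ (elements S)) (length-elements S))) |S|
      C : List (Colour t)
      C = toList (pad (map (lookup χ) (elements S)) |χS| (Vec.replicate t false))
      C∈ : C ∈ candidates
      C∈ = ∈-map⁺ toList (∈-vectors ∈-colours _)
      covers : ∀ {τ} → τ ∈ yesTuples χ → Covers C τ
      covers τ∈ with find (proj₂ (∈-filter⁻ (gpis? H ∘ colourQuery χ) {xs = validTuples χ} τ∈))
      ... | (e , e∈ , (u , u∈A , image)) with All.lookup hits e∈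
      ... | (v , v∈S∩e) with Subsetₚ.x∈p∩q⁻ S e v∈S∩e
      ... | (v∈S , v∈e) with proj₁ (image v) v∈e
      ... | (i , refl) =
        i , subst (_∈ C) (∈-class⁻ χ (u∈A i)) (∈-pad _ |χS| _ (∈-map⁺ (lookup χ) (∈-elements⁺ v∈S)))

    edge-tuple : ∀ χ {X} → InjectiveOn χ X → ∀ {e} → e ∈ edges H → elements e ⊆ X →
                 Σ Tuple λ τ → τ ∈ yesTuples χ × (∀ i → ∃ λ v → v ∈ elements e × lookup χ v ≡ lookup τ i)
    edge-tuple χ injective {e} e∈ e⊆X
      with enumerate (elements e) d (trans (length-elements e) (All.lookup (uniform H) e∈)) (elements-unique e)
    ... | (u , u∈ , onto , u-injective) = τ , τ∈ , λ i → u i , u∈ i , sym (colour i)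
      where
      τ : Tuple
      τ = tabulate (lookup χ ∘ u)
      colour : ∀ i → lookup τ i ≡ lookup χ (u i)
      colour = Vecₚ.lookup∘tabulate (lookup χ ∘ u)
      valid : ValidTuple χ τ
      valid = (λ i → u i , sym (colour i)) ,
              λ i j i≢j τi≡τj → i≢j (u-injective i j
                (injective (e⊆X (u∈ i)) (e⊆X (u∈ j)) (trans (sym (colour i)) (trans τi≡τj (colour j)))))
      fits : EdgeFits (colourQuery χ τ) e
      fits = u , (λ i → ∈-class⁺ χ (sym (colour i))) ,
             λ v → (λ v∈e → onto (∈-elements⁺ v∈e)) ,
                   (λ (i , ui≡v) → ∈-elements⁻ (subst (_∈ elements e) ui≡v (u∈ i)))
      τ∈ : τ ∈ yesTuples χ
      τ∈ = ∈-filter⁺ (gpis? H ∘ colourQuery χ)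
             (∈-filter⁺ (validTuple? χ) (∈-vectors ∈-colours τ) valid) (lose e∈ fits)

    -- Completeness: if χ is injective on a k-kernel X of the edges, a set of k
    -- colours covering the "yes" tuples pulls back to a hitting set of size ≤ k.
    round-complete : ∀ χ X → IsKernel k (map elements (edges H)) X → InjectiveOn χ X →
                     ¬ HasHittingSet H k → roundOK χ ≡ false
    round-complete χ X kernel injective ¬hs =
      dec-false (coverable? (yesTuples χ)) (λ coverable → ¬hs (hittingSet coverable))
      where
      hittingSet : Coverable (yesTuples χ) → HasHittingSet H k
      hittingSet coverable with find coverable
      ... | (C , C∈ , covers) = fromList W , ≤-trans (∣fromList∣≤length W) |W| , All.tabulate meets
        where
        W : List (Fin n)
        W = pullback χ X C
        |W| : length W ≤ k
        |W| with ∈-map⁻ toList C∈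
        ... | (v , _ , refl) = ≤-trans (length-pullback χ X C) (≤-reflexive (Vecₚ.length-toList v))
        metInside : ∀ {e} → e ∈ map elements (edges H) → e ⊆ X → Meets W e
        metInside e∈ e⊆X with ∈-map⁻ elements e∈
        ... | (e₀ , e₀∈ , refl) with edge-tuple χ injective e₀∈ e⊆X
        ... | (τ , τ∈ , colourOf) with All.lookup covers τ∈
        ... | (i , τi∈C) with colourOf i
        ... | (v , v∈e , χv≡τi) =
          lose v∈e (∈-pullback injective (e⊆X v∈e) (subst (_∈ C) (sym χv≡τi) τi∈C))
        meets : ∀ {e} → e ∈ edges H → Nonempty (fromList W ∩ e)
        meets e∈ with find (kernel W |W| metInside (∈-map⁺ elements e∈))
        ... | (v , v∈e , v∈W) = v , Subsetₚ.x∈p∩q⁺ (∈-fromList v∈W , ∈-elements⁻ v∈e)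

-- Since ⌊log₂ (2^m)⌋ = m and ⌊log₂⌋ is monotone.
k<2^[1+⌊log₂k⌋] : ∀ k → k < 2 ^ suc ⌊log₂ k ⌋
k<2^[1+⌊log₂k⌋] k = ≰⇒> λ 2^[1+l]≤k →
  1+n≰n (subst (_≤ ⌊log₂ k ⌋) (⌊log₂[2^n]⌋≡n (suc ⌊log₂ k ⌋)) (⌊log₂⌋-mono-≤ 2^[1+l]≤k))

1≤⌊log₂k⌋ : ∀ k → 2 ≤ k → 1 ≤ ⌊log₂ k ⌋
1≤⌊log₂k⌋ k 2≤k = ⌊log₂⌋-mono-≤ 2≤k

-- Strong induction through ⌊log₂ k⌋ = 1 + ⌊log₂ ⌊k/2⌋⌋ for k ≥ 2.
2^⌊log₂k⌋≤k : ∀ k → 1 ≤ k → 2 ^ ⌊log₂ k ⌋ ≤ k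
2^⌊log₂k⌋≤k = <-rec (λ k → 1 ≤ k → 2 ^ ⌊log₂ k ⌋ ≤ k) halve-step
  where
  halve-step : ∀ k → (∀ {j} → j < k → 1 ≤ j → 2 ^ ⌊log₂ j ⌋ ≤ j) → 1 ≤ k → 2 ^ ⌊log₂ k ⌋ ≤ k
  halve-step 1                 _   _ = ≤-refl
  halve-step k@(suc (suc m))   rec _ = begin
    2 ^ ⌊log₂ k ⌋               ≡⟨ cong (2 ^_) halve ⟩
    2 * 2 ^ ⌊log₂ ⌊ k /2⌋ ⌋     ≤⟨ *-monoʳ-≤ 2 (rec (⌊n/2⌋<n (suc m)) (s≤s z≤n)) ⟩
    2 * ⌊ k /2⌋                 ≡⟨ cong (⌊ k /2⌋ +_) (+-identityʳ _) ⟩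
    ⌊ k /2⌋ + ⌊ k /2⌋           ≤⟨ +-monoʳ-≤ ⌊ k /2⌋ (⌊n/2⌋≤⌈n/2⌉ k) ⟩
    ⌊ k /2⌋ + ⌈ k /2⌉           ≡⟨ ⌊n/2⌋+⌈n/2⌉≡n k ⟩
    k                           ∎
    where
    open ≤-Reasoning
    halve : ⌊log₂ k ⌋ ≡ suc ⌊log₂ ⌊ k /2⌋ ⌋
    halve = sym (trans (cong suc (⌊log₂⌊n/2⌋⌋≡⌊log₂n⌋∸1 k)) (m+[n∸m]≡n (1≤⌊log₂k⌋ k (s≤s (s≤s z≤n)))))

^-distribʳ-* : ∀ m n o → (m * n) ^ o ≡ m ^ o * n ^ o
^-distribʳ-* m n zero    = refl
^-distribʳ-* m n (suc o) = begin
  m * n * (m * n) ^ o        ≡⟨ cong (m * n *_) (^-distribʳ-* m n o) ⟩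
  m * n * (m ^ o * n ^ o)    ≡⟨ [m*n]*[o*p]≡[m*o]*[n*p] m n (m ^ o) (n ^ o) ⟩
  m * m ^ o * (n * n ^ o)    ∎
  where open ≡-Reasoning

1+n≤2^n : ∀ n → suc n ≤ 2 ^ n
1+n≤2^n zero    = s≤s z≤n
1+n≤2^n (suc n) = +-mono-≤ (m^n>0 2 n) (≤-trans (1+n≤2^n n) (≤-reflexive (sym (+-identityʳ _))))

-- One round fails with probability ≤ 1/2: if c out of P outcomes are bad, with
-- c·N ≤ s²·P, and N ≥ 2s², then 2c ≤ P.
halving : ∀ {c s N P} .{{_ : NonZero N}} → c * N ≤ s * (s * P) → 2 * (s * s) ≤ N → c * 2 ≤ P
halving {c} {s} {N} {P} bad 2s²≤N = *-cancelʳ-≤ (c * 2) P N (begin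
  c * 2 * N            ≡⟨ regroupˡ c N ⟩
  2 * (c * N)          ≤⟨ *-monoʳ-≤ 2 bad ⟩
  2 * (s * (s * P))    ≡⟨ regroupʳ s P ⟩
  2 * (s * s) * P      ≤⟨ *-monoˡ-≤ P 2s²≤N ⟩
  N * P                ≡⟨ *-comm N P ⟩
  P * N                ∎)
  where
  open ≤-Reasoning
  regroupˡ : ∀ c N → c * 2 * N ≡ 2 * (c * N)
  regroupˡ = solve-∀
  regroupʳ : ∀ s P → 2 * (s * (s * P)) ≡ 2 * (s * s) * P
  regroupʳ = solve-∀

-- Amplification: L independent rounds, each failing with probability ≤ 1/2,
-- all fail with probability ≤ 2^-L < 1/k.
amplify : ∀ {c P} L k → c * 2 ≤ P → k ≤ 2 ^ L → c ^ L * k ≤ P ^ L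
amplify {c} {P} L k 2c≤P k≤2^L = begin
  c ^ L * k        ≤⟨ *-monoʳ-≤ (c ^ L) k≤2^L ⟩
  c ^ L * 2 ^ L    ≡⟨ sym (^-distribʳ-* c 2 L) ⟩
  (c * 2) ^ L      ≤⟨ ^-monoˡ-≤ L 2c≤P ⟩
  P ^ L            ∎
  where open ≤-Reasoning

module Parameters (d : ℕ) where

  -- The number of independent rounds: 2^rounds > k.
  rounds : ℕ → ℕ
  rounds k = suc ⌊log₂ k ⌋

  -- The kernel (built with A = d(k+1)) has fewer than (A+1)^d ≤ 2^(kernelExp k) vertices.
  kernelExp : ℕ → ℕ
  kernelExp k = (d + rounds k) * d

  -- Colours are bit strings of this length, so there are 2·(2^kernelExp)² of them.
  colourBits : ℕ → ℕ
  colourBits k = suc (kernelExp k + kernelExp k)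

  2^rounds≤2k : ∀ k → 1 ≤ k → 2 ^ rounds k ≤ 2 * k
  2^rounds≤2k k 1≤k = *-monoʳ-≤ 2 (2^⌊log₂k⌋≤k k 1≤k)

  -- (A+1)^d ≤ 2^kernelExp for A = d(k+1), because d(k+1)+1 ≤ (d+1)·2^rounds ≤ 2^(d+rounds).
  kernel-small : ∀ k → suc (d * suc k) ^ d ≤ 2 ^ kernelExp k
  kernel-small k = begin
    suc (d * suc k) ^ d          ≤⟨ ^-monoˡ-≤ d A+1≤ ⟩
    (2 ^ (d + rounds k)) ^ d     ≡⟨ ^-*-assoc 2 (d + rounds k) d ⟩
    2 ^ kernelExp k              ∎
    where
    open ≤-Reasoning
    L : ℕ
    L = rounds k
    A+1≤ : suc (d * suc k) ≤ 2 ^ (d + L)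
    A+1≤ = begin
      suc (d * suc k)        ≤⟨ s≤s (*-monoʳ-≤ d (k<2^[1+⌊log₂k⌋] k)) ⟩
      suc (d * 2 ^ L)        ≤⟨ +-monoˡ-≤ (d * 2 ^ L) (m^n>0 2 L) ⟩
      suc d * 2 ^ L          ≤⟨ *-monoˡ-≤ (2 ^ L) (1+n≤2^n d) ⟩
      2 ^ d * 2 ^ L          ≡⟨ sym (^-distribˡ-+-* 2 d L) ⟩
      2 ^ (d + L)            ∎

  many-colours : ∀ k {s} → s ≤ 2 ^ kernelExp k → 2 * (s * s) ≤ 2 ^ colourBits k
  many-colours k {s} s≤ = begin
    2 * (s * s)                                ≤⟨ *-monoʳ-≤ 2 (*-mono-≤ s≤ s≤) ⟩
    2 * (2 ^ kernelExp k * 2 ^ kernelExp k)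
      ≡⟨ cong (2 *_) (sym (^-distribˡ-+-* 2 (kernelExp k) (kernelExp k))) ⟩
    2 ^ colourBits k                           ∎
    where open ≤-Reasoning

  C : ℕ
  C = 2 * (2 ^ d * ((2 ^ d * 2) ^ (d * d) * (2 ^ d * 2) ^ (d * d)))

  query-bound : ∀ k → 2 ≤ k → rounds k * (2 ^ colourBits k) ^ d ≤ C * k ^ (2 * (d * d)) * ⌊log₂ k ⌋
  query-bound k 2≤k = begin
    L * (2 ^ colourBits k) ^ d               ≡⟨ cong (L *_) colours^d ⟩
    L * (2 ^ d * (P * P))                    ≤⟨ *-mono-≤ L≤2lg (*-monoʳ-≤ (2 ^ d) (*-mono-≤ P≤QK P≤QK)) ⟩
    (2 * lg) * (2 ^ d * ((Q * K) * (Q * K))) ≡⟨ regroup lg (2 ^ d) Q K ⟩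
    C * (K * K) * lg                         ≡⟨ cong (λ z → C * z * lg) (sym k^2d²) ⟩
    C * k ^ (2 * (d * d)) * lg               ∎
    where
    open ≤-Reasoning
    L lg e P Q K : ℕ
    L = rounds k
    lg = ⌊log₂ k ⌋
    e = kernelExp k
    P = 2 ^ (e * d)
    Q = (2 ^ d * 2) ^ (d * d)
    K = k ^ (d * d)
    L≤2lg : L ≤ 2 * lg
    L≤2lg = ≤-trans (s≤s (m≤m+n lg 0)) (+-monoˡ-≤ (lg + 0) (1≤⌊log₂k⌋ k 2≤k))
    colours^d : (2 ^ colourBits k) ^ d ≡ 2 ^ d * (P * P)
    colours^d = begin-equality
      (2 ^ colourBits k) ^ d        ≡⟨ ^-*-assoc 2 (colourBits k) d ⟩
      2 ^ (d + (e + e) * d)         ≡⟨ cong (λ z → 2 ^ (d + z)) (*-distribʳ-+ d e e) ⟩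
      2 ^ (d + (e * d + e * d))     ≡⟨ ^-distribˡ-+-* 2 d _ ⟩
      2 ^ d * 2 ^ (e * d + e * d)   ≡⟨ cong (2 ^ d *_) (^-distribˡ-+-* 2 (e * d) (e * d)) ⟩
      2 ^ d * (P * P)               ∎
    P≤QK : P ≤ Q * K
    P≤QK = begin
      2 ^ (e * d)                     ≡⟨ cong (2 ^_) (*-assoc (d + L) d d) ⟩
      2 ^ ((d + L) * (d * d))         ≡⟨ sym (^-*-assoc 2 (d + L) (d * d)) ⟩
      (2 ^ (d + L)) ^ (d * d)         ≡⟨ cong (_^ (d * d)) (^-distribˡ-+-* 2 d L) ⟩
      (2 ^ d * 2 ^ L) ^ (d * d)
        ≤⟨ ^-monoˡ-≤ (d * d) (*-monoʳ-≤ (2 ^ d) (2^rounds≤2k k (≤-trans (s≤s z≤n) 2≤k))) ⟩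
      (2 ^ d * (2 * k)) ^ (d * d)     ≡⟨ cong (_^ (d * d)) (sym (*-assoc (2 ^ d) 2 k)) ⟩
      (2 ^ d * 2 * k) ^ (d * d)       ≡⟨ ^-distribʳ-* (2 ^ d * 2) k (d * d) ⟩
      Q * K                           ∎
    k^2d² : k ^ (2 * (d * d)) ≡ K * K
    k^2d² = trans (^-distribˡ-+-* k (d * d) (d * d + 0)) (cong (λ z → K * k ^ z) (+-identityʳ (d * d)))
    regroup : ∀ l D b x → (2 * l) * (D * ((b * x) * (b * x))) ≡ (2 * (D * (b * b))) * (x * x) * l
    regroup = solve-∀

-- Reading random bits as vectors of vectors: concatenation is injective, so grouping
-- a concatenation gives back the original vectors.

++-cancel : ∀ {m n} (xs ys : Vec A m) {zs ws : Vec A n} →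
            xs Vec.++ zs ≡ ys Vec.++ ws → xs ≡ ys × zs ≡ ws
++-cancel []       []       eq = refl , eq
++-cancel (x ∷ xs) (y ∷ ys) eq with Vecₚ.∷-injective eq
... | (refl , eq′) = let (xs≡ys , zs≡ws) = ++-cancel xs ys eq′ in cong (x ∷_) xs≡ys , zs≡ws

concat-injective : ∀ {m n} (xss yss : Vec (Vec A m) n) → Vec.concat xss ≡ Vec.concat yss → xss ≡ yss
concat-injective []         []         _  = refl
concat-injective (xs ∷ xss) (ys ∷ yss) eq with ++-cancel xs ys eq
... | (refl , eq′) = cong (xs ∷_) (concat-injective xss yss eq′)

group-concat : ∀ n m (xss : Vec (Vec A m) n) → proj₁ (Vec.group n m (Vec.concat xss)) ≡ xss
group-concat n m xss = concat-injective _ xss (sym (proj₂ (Vec.group n m (Vec.concat xss))))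

encode : ∀ {L n t} → Vec (Vec (Vec Bool t) n) L → Vec Bool (L * (n * t))
encode σ = Vec.concat (Vec.map Vec.concat σ)

decode : ∀ L n t → Vec Bool (L * (n * t)) → Vec (Vec (Vec Bool t) n) L
decode L n t ρ = Vec.map (proj₁ ∘ Vec.group n t) (proj₁ (Vec.group L (n * t) ρ))

decode-encode : ∀ {L n t} (σ : Vec (Vec (Vec Bool t) n) L) → decode L n t (encode σ) ≡ σ
decode-encode {L} {n} {t} σ = begin
  Vec.map (proj₁ ∘ Vec.group n t) (proj₁ (Vec.group L (n * t) (encode σ)))
    ≡⟨ cong (Vec.map _) (group-concat L (n * t) (Vec.map Vec.concat σ)) ⟩
  Vec.map (proj₁ ∘ Vec.group n t) (Vec.map Vec.concat σ)
    ≡⟨ sym (Vecₚ.map-∘ _ Vec.concat σ) ⟩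
  Vec.map (proj₁ ∘ Vec.group n t ∘ Vec.concat) σ
    ≡⟨ Vecₚ.map-cong (group-concat n t) σ ⟩
  Vec.map (λ χ → χ) σ
    ≡⟨ Vecₚ.map-id σ ⟩
  σ ∎
  where open ≡-Reasoning

encode-injective : ∀ {L n t} {σ σ′ : Vec (Vec (Vec Bool t) n) L} → encode σ ≡ encode σ′ → σ ≡ σ′
encode-injective {σ = σ} {σ′} eq =
  trans (sym (decode-encode σ)) (trans (cong (decode _ _ _) eq) (decode-encode σ′))

module Algorithm (d : ℕ) where

  open Parameters d public

  algorithm : RandAlg d
  algorithm n k = rounds k * (n * colourBits k) ,
                  λ ρ → allTests (ColourCoding.roundTest {d} {n} {colourBits k} k)
                                 (decode (rounds k) n (colourBits k) ρ)

  module Analysis (n k : ℕ) (H : Hypergraph d n) where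

    open ColourCoding {d} {n} {colourBits k} k
    open Kernel (Fin._≟_ {n}) using (kernel; kernelSize; kernelSize<; IsKernel)

    private
      t L r : ℕ
      t = colourBits k
      L = rounds k
      r = L * (n * t)

    Tree : Vec Bool r → QTree d n
    Tree = proj₂ (algorithm n k)

    |colours| : length (colours t) ≡ 2 ^ t
    |colours| = length-vectors bits t

    run : ∀ (σ : Vec Colouring L) →
          ∃ λ q → Exec H (allTests roundTest σ) (allᵥ (roundOK H) σ) q × q ≤ L * length (colours t) ^ d
    run = allTests-exec H roundTest (roundOK H) _ (round-computes H)

    queries : 2 ≤ k → ∀ ρ → ∃ λ out → ∃ λ q → Exec H (Tree ρ) out q × q ≤ C * k ^ (2 * (d * d)) * ⌊log₂ k ⌋
    queries 2≤k ρ with run (decode L n t ρ)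
    ... | (q , exec , q≤) =
      _ , q , exec , ≤-trans q≤ (≤-trans (≤-reflexive (cong (λ N → L * N ^ d) |colours|)) (query-bound k 2≤k))

    -- The sample space: all choices of L colourings, in bijection with the random strings.
    outcomes : List (Vec Colouring L)
    outcomes = vectors (vectors (colours t) n) L

    outcomes-unique : Unique outcomes
    outcomes-unique = listing-unique (Vecₚ.≡-dec (Vecₚ.≡-dec _≟ᶜ_)) {outcomes}
      (vectors-listing (Vecₚ.≡-dec _≟ᶜ_) {vectors (colours t) n}
        (vectors-listing _≟ᶜ_ {colours t} (colours-listing t) n) L)

    space : (length (colours t) ^ n) ^ L ≡ 2 ^ r
    space = begin
      (length (colours t) ^ n) ^ L               ≡⟨ cong (λ N → (N ^ n) ^ L) |colours| ⟩
      ((2 ^ t) ^ n) ^ L                          ≡⟨ cong (_^ L) (^-*-assoc 2 t n) ⟩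
      (2 ^ (t * n)) ^ L                          ≡⟨ ^-*-assoc 2 (t * n) L ⟩
      2 ^ (t * n * L)                            ≡⟨ cong (2 ^_) (trans (*-comm (t * n) L) (cong (L *_) (*-comm t n))) ⟩
      2 ^ r                                      ∎
      where open ≡-Reasoning

    |outcomes| : length outcomes ≡ 2 ^ r
    |outcomes| = trans (length-vectors (vectors (colours t) n) L)
                       (trans (cong (_^ L) (length-vectors (colours t) n)) space)

    tree-encode : ∀ (σ : Vec Colouring L) → Tree (encode σ) ≡ allTests roundTest σ
    tree-encode σ = cong (allTests roundTest) (decode-encode σ)

    good-run : ∀ (σ : Vec Colouring L) → CorrectOut H k (allᵥ (roundOK H) σ) → GoodString H k Tree (encode σ)
    good-run σ correct =
      let (q , exec , _) = run σ
      in allᵥ (roundOK H) σ , q ,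
         subst (λ tree → Exec H tree (allᵥ (roundOK H) σ) q) (sym (tree-encode σ)) exec , correct

    success-from : ∀ (ok : Vec Colouring L → Bool) →
                   (∀ σ → ok σ ≡ true → GoodString H k Tree (encode σ)) →
                   count (not ∘ ok) outcomes * k ≤ 2 ^ r → SuccessProb H k Tree 1 1
    success-from ok good bad≤ = map encode passed , unique , All.tabulate goodness , bound
      where
      passed : List (Vec Colouring L)
      passed = filterᵇ ok outcomes
      unique : Unique (map encode passed)
      unique = Unique.map⁺ encode-injective (Unique.filter⁺ (T? ∘ ok) outcomes-unique)
      goodness : ∀ {ρ} → ρ ∈ map encode passed → GoodString H k Tree ρ
      goodness ρ∈ with ∈-map⁻ encode ρ∈
      ... | (σ , σ∈ , refl) = good σ (Equivalence.to T-≡ (proj₂ (∈-filter⁻ (T? ∘ ok) {xs = outcomes} σ∈)))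
      failed : 2 ^ r ∸ length (map encode passed) ≡ count (not ∘ ok) outcomes
      failed = begin
        2 ^ r ∸ length (map encode passed)
          ≡⟨ cong₂ _∸_ (sym |outcomes|) (length-map encode passed) ⟩
        length outcomes ∸ length passed
          ≡⟨ cong (_∸ length passed) (sym (length-filterᵇ ok outcomes)) ⟩
        length passed + count (not ∘ ok) outcomes ∸ length passed
          ≡⟨ m+n∸m≡n (length passed) _ ⟩
        count (not ∘ ok) outcomes ∎
        where open ≡-Reasoning
      bound : (2 ^ r ∸ length (map encode passed)) ^ 1 * k ^ 1 ≤ (2 ^ r) ^ 1
      bound = subst₂ _≤_ (sym (cong₂ _*_ (trans (^-identityʳ _) failed) (^-identityʳ k)))
                         (sym (^-identityʳ _)) bad≤

    success-yes : HasHittingSet H k → SuccessProb H k Tree 1 1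
    success-yes hs = success-from (λ _ → true) (λ σ _ → good-run σ (correct σ)) never-fails
      where
      correct : ∀ σ → CorrectOut H k (allᵥ (roundOK H) σ)
      correct σ rewrite allᵥ-true (round-sound H hs) σ = (λ _ → hs) , (λ ())
      never-fails : count (λ _ → false) outcomes * k ≤ 2 ^ r
      never-fails = subst (λ c → c * k ≤ 2 ^ r) (sym (count-const false outcomes)) z≤n

    edgeSets : List (List (Fin n))
    edgeSets = map elements (edges H)

    edgeSets-small : ∀ {e} → e ∈ edgeSets → length e ≤ d
    edgeSets-small e∈ with ∈-map⁻ elements e∈
    ... | (e , e∈H , refl) = ≤-reflexive (trans (length-elements e) (All.lookup (uniform H) e∈H))

    edgeKernel : Σ (List (Fin n)) λ X → length X ≤ kernelSize (d * suc k) d × IsKernel k edgeSets X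
    edgeKernel = kernel d k (d * suc k) ≤-refl edgeSets edgeSets-small

    X : List (Fin n)
    X = proj₁ edgeKernel

    open Collisions _≟ᶜ_ {colours t} (colours-listing t) using (collides; injective-on; count-collides)

    accepts⇒collides : ¬ HasHittingSet H k → ∀ χ → roundOK H χ ≡ true → collides X χ ≡ true
    accepts⇒collides ¬hs χ accepts with collides X χ in noClash
    ... | true  = refl
    ... | false with () ← trans (sym accepts)
                            (round-complete H χ X (proj₂ (proj₂ edgeKernel)) (injective-on X χ noClash) ¬hs)

    -- A colouring collides on X with probability ≤ |X|²/2^t ≤ 1/2, so all L
    -- rounds collide with probability ≤ 2^-L < 1/k.
    collisions-rare : count (allᵥ (collides X)) outcomes * k ≤ 2 ^ r
    collisions-rare = begin
      count (allᵥ (collides X)) outcomes * k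
        ≡⟨ cong (_* k) (count-allᵥ (vectors (colours t) n) (collides X) L) ⟩
      c ^ L * k
        ≤⟨ amplify {c} {N ^ n} L k halved (<⇒≤ (k<2^[1+⌊log₂k⌋] k)) ⟩
      (N ^ n) ^ L
        ≡⟨ space ⟩
      2 ^ r ∎
      where
      open ≤-Reasoning
      c N : ℕ
      c = count (collides X) (vectors (colours t) n)
      N = length (colours t)
      |X| : length X ≤ 2 ^ kernelExp k
      |X| = ≤-trans (proj₁ (proj₂ edgeKernel)) (≤-trans (<⇒≤ (kernelSize< (d * suc k) d)) (kernel-small k))
      halved : c * 2 ≤ N ^ n
      halved = halving {c} {length X} {N} {N ^ n} {{>-nonZero (subst (0 <_) (sym |colours|) (m^n>0 2 t))}}
                 (count-collides X) (subst (2 * (length X * length X) ≤_) (sym |colours|) (many-colours k |X|))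

    success-no : ¬ HasHittingSet H k → SuccessProb H k Tree 1 1
    success-no ¬hs = success-from noCollision good rarely-fails
      where
      noCollision : Vec Colouring L → Bool
      noCollision σ = not (allᵥ (collides X) σ)
      good : ∀ σ → noCollision σ ≡ true → GoodString H k Tree (encode σ)
      good σ someRoundInjective = good-run σ correct
        where
        correct : CorrectOut H k (allᵥ (roundOK H) σ)
        correct with allᵥ (roundOK H) σ in accepted
        ... | false = (λ ()) , (λ _ → ¬hs)
        ... | true with () ← trans (sym someRoundInjective)
                                   (cong not (allᵥ-mono (accepts⇒collides ¬hs) σ accepted))
      rarely-fails : count (not ∘ noCollision) outcomes * k ≤ 2 ^ r
      rarely-fails = subst (λ m → m * k ≤ 2 ^ r)
                       (sym (count-cong (λ σ → not-involutive (allᵥ (collides X) σ)) outcomes)) collisions-rare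

    success : SuccessProb H k Tree 1 1
    success with hittingSet? H k
    ... | yes hs = success-yes hs
    ... | no ¬hs = success-no ¬hs

theorem6 : (d : ℕ) → 2 ≤ d →
    Σ (RandAlg d) λ alg →
    Σ ℕ λ C → Σ ℕ λ K₀ → Σ ℕ λ a → Σ ℕ λ b → 1 ≤ a × 1 ≤ b ×
      (∀ (n k : ℕ) → (H : Hypergraph d n) →
        (K₀ ≤ k → ∀ ρ → ∃ λ out → ∃ λ q →
           Exec H (proj₂ (alg n k) ρ) out q × q ≤ C * k ^ (2 * (d * d)) * ⌊log₂ k ⌋)
        × (1 ≤ k → SuccessProb H k (proj₂ (alg n k)) a b))
theorem6 d _ =
  algorithm , C , 2 , 1 , 1 , s≤s z≤n , s≤s z≤n ,
  λ n k H → Analysis.queries n k H , λ _ → Analysis.success n k H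
  where open Algorithm d
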